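{- The provability logic $\mathsf{GL}$ is complete for finite transitive irreflexive provability models having necessitation and Löb's rule: if $A\in\mathcal L_\Box$ holds at every world of every such model, then $\mathsf{GL}\vdash A$.
   Context: $\mathsf{GL}$ is $\mathsf K$ (the smallest normal modal logic) plus $\Box A\to\Box\Box A$ and $\Box(\Box A\to A)\to\Box A$. Language $\mathcal L_\Box$: formulas built from atomic propositions and $\bot$ using $\to$ and a unary $\Box$. A formula is purely modal if it is a Boolean combination of formulas $\Box B$. A theory is a pair of a set of axioms and a set of inference rules (finitely many premises, one conclusion); $\mathsf T\vdash A$ means derivability from axioms by rules. A theory is classical if modus ponens is one of its rules and all classical tautologies are derivable. A provability pre-model is $\mathcal P=(W,\sqsubset,\{L_w\}_{w\in W^\sqsubset},V)$ with $W$ nonempty, $\sqsubset$ a binary relation on $W$, $V\subseteq W\times\mathrm{atoms}$, $W^\sqsubset=\{u:\exists v\,(v\sqsubset u)\}$, and a theory $L_w$ for each $w\in W^\sqsubset$. Satisfaction: atoms via $V$, $\bot$ never holds, $\to$ classical, $\mathcal P,w\Vdash\Box A$ iff $L_u\vdash A$ for all $u$ with $w\sqsubset u$. With $\sqsubset^+$ the transitive closure, $\mathcal P,w\Vdash^+A$ iff there is $u\sqsubset w$ with $\mathcal P,v\Vdash A$ for all $v$ such that $u\sqsubset^+v$. A provability model is a pre-model in which every $L_w$ is classical and which satisfies modal completeness: for every $w\in W^\sqsubset$ and purely modal $A$, $\mathcal P,w\Vdash^+A$ implies $L_w\vdash A$. Necessitation: every $L_w$ has the rule "from $A$ infer $\Box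 A$"; Löb's rule: every $L_w$ has the rule "from $\Box A\to A$ infer $A$". -}

module Defs where

open import Data.Nat using (ℕ; suc)
open import Data.Bool using (Bool; true; false; _∧_; not; _∨_)
open import Data.List using (List; []; _∷_)
open import Data.List.Relation.Unary.All using (All)
open import Data.Product using (Σ; ∃; _×_; _,_)
open import Data.Sum using (_⊎_)
open import Data.Empty using (⊥)
open import Data.Fin using (Fin)
open import Relation.Nullary using (¬_)
open import Relation.Binary.PropositionalEquality using (_≡_)
open import Relation.Binary.Construct.Closure.Transitive using (TransClosure)
open import Function.Bundles using (_↔_)

infixr 6 _⇒_
data Form : Set where
  var  : ℕ → Form
  ⊥'   : Form
  _⇒_  : Form → Form → Form
  □_   : Form → Form

data PurelyModal : Form → Set where
  pm-□ : ∀ B → PurelyModal (□ B)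
  pm-⊥ : PurelyModal ⊥'
  pm-⇒ : ∀ {A B} → PurelyModal A → PurelyModal B → PurelyModal (A ⇒ B)

-- Classical tautologies: true under every Boolean valuation of the
-- atoms and of the boxed subformulas (which are treated as atoms).

evalB : (Form → Bool) → Form → Bool
evalB v (var p) = v (var p)
evalB v ⊥'      = false
evalB v (A ⇒ B) = not (evalB v A) ∨ evalB v B
evalB v (□ A)   = v (□ A)

Tautology : Form → Set
Tautology A = ∀ (v : Form → Bool) → evalB v A ≡ true

record Theory : Set₁ where
  field
    Ax   : Form → Set
    Rule : List Form → Form → Set
open Theory public

infix 3 _⊢_
data _⊢_ (T : Theory) : Form → Set where
  ax   : ∀ {A} → Ax T A → T ⊢ A
  rule : ∀ {ps A} → Rule T ps A → All (T ⊢_) ps → T ⊢ A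

HasMP : Theory → Set
HasMP T = ∀ A B → Rule T (A ∷ (A ⇒ B) ∷ []) B

Classical : Theory → Set
Classical T = HasMP T × (∀ A → Tautology A → T ⊢ A)

data GLAx : Form → Set where
  taut : ∀ {A} → Tautology A → GLAx A
  axK  : ∀ A B → GLAx (□ (A ⇒ B) ⇒ (□ A ⇒ □ B))
  ax4  : ∀ A → GLAx (□ A ⇒ □ □ A)
  axL  : ∀ A → GLAx (□ (□ A ⇒ A) ⇒ □ A)

data GLRule : List Form → Form → Set where
  mp  : ∀ A B → GLRule (A ∷ (A ⇒ B) ∷ []) B
  nec : ∀ A → GLRule (A ∷ []) (□ A)

GL : Theory
GL = record { Ax = GLAx ; Rule = GLRule }

-- Provability pre-models.  The family {L_w} is given as a total function
-- W → Theory; only its values on W^⊏ are ever used.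

record PreModel : Set₁ where
  field
    W    : Set
    inh  : W
    _⊏_  : W → W → Set
    L    : W → Theory
    V    : W → ℕ → Set

  InW⊏ : W → Set
  InW⊏ u = ∃ λ v → v ⊏ u

  _⊏⁺_ : W → W → Set
  _⊏⁺_ = TransClosure _⊏_

  infix 4 _⊩_ _⊩⁺_
  _⊩_ : W → Form → Set
  w ⊩ var p   = V w p
  w ⊩ ⊥'      = ⊥
  w ⊩ (A ⇒ B) = w ⊩ A → w ⊩ B
  w ⊩ (□ A)   = ∀ u → w ⊏ u → L u ⊢ A

  _⊩⁺_ : W → Form → Set
  w ⊩⁺ A = ∃ λ u → u ⊏ w × (∀ v → u ⊏⁺ v → v ⊩ A)

  AllClassical : Set
  AllClassical = ∀ w → InW⊏ w → Classical (L w)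

  ModalComplete : Set
  ModalComplete = ∀ w → InW⊏ w → ∀ A → PurelyModal A → w ⊩⁺ A → L w ⊢ A

  IsProvabilityModel : Set
  IsProvabilityModel = AllClassical × ModalComplete

  Finite : Set
  Finite = Σ ℕ λ n → W ↔ Fin n

  Transitive : Set
  Transitive = ∀ {x y z} → x ⊏ y → y ⊏ z → x ⊏ z

  Irreflexive : Set
  Irreflexive = ∀ x → ¬ (x ⊏ x)

  HasNecessitation : Set
  HasNecessitation = ∀ w → InW⊏ w → ∀ A → Rule (L w) (A ∷ []) (□ A)

  HasLöbRule : Set
  HasLöbRule = ∀ w → InW⊏ w → ∀ A → Rule (L w) ((□ A ⇒ A) ∷ []) A

Valid : PreModel → Form → Set
Valid P A = ∀ w → w ⊩ A
  where open PreModel P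

-- A finite transitive Kripke model whose relation is conversely well-founded
-- (witnessed here by a rank) becomes a provability model with necessitation
-- and Löb's rule when L_w is taken to be the theory of the cone generated by
-- w: all three rules are sound on cones (Löb's rule by induction on the
-- rank), and truth in the Kripke model coincides with truth in the
-- provability model.  So it suffices that GL is complete for such models.
-- This is shown by a terminating proof search in the sequent calculus for GL.
-- The propositional rules are invertible; once only atoms and boxes are left,
-- either the sequent contains a complementary pair, or for some □C on the
-- right the premise  G, □G, □C ⊢ C  of the GL rule is provable, or the
-- countermodels to all these premises, put side by side below a new root,
-- form a countermodel to the sequent.  Each modal step moves one more boxed
-- subformula of A to the left, so the search terminates.

module Submission where

open import Defs
open import Data.Bool using (Bool; true; false; T; not; _∨_)
import Data.Bool as Bool
open import Data.Empty using (⊥; ⊥-elim)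
open import Data.Fin using (Fin; zero; suc; punchOut)
open import Data.Fin.Properties using (all?; +↔⊎; 0↔⊥; 1↔⊤)
open import Data.List using (List; []; _∷_; _++_; map)
import Data.List.Membership.DecPropositional as DecMembership
open import Data.List.Membership.Propositional using (_∈_; find; lose)
open import Data.List.Membership.Propositional.Properties using (∈-++⁻; ∈-++⁺ˡ; ∈-++⁺ʳ; ∈-map⁺; ∈-map⁻)
open import Data.List.Relation.Binary.Permutation.Propositional using (_↭_; ↭-sym)
open import Data.List.Relation.Binary.Permutation.Propositional.Properties using (Any-resp-↭; shift)
open import Data.List.Relation.Binary.Subset.Propositional using (_⊆_)
open import Data.List.Relation.Unary.All as All using (All; []; _∷_)
import Data.List.Relation.Unary.All.Properties as All
open import Data.List.Relation.Unary.Any using (Any; here; there; any?)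
import Data.List.Relation.Unary.Any.Properties as Any
open import Data.Nat using (ℕ; zero; suc; _+_; _≤_; _<_; s≤s)
import Data.Nat as ℕ
open import Data.Nat.Properties using (≤-refl; ≤-trans; <-≤-trans; <-irrefl; m≤m+n; m≤n+m; m<n⇒m<1+n; +-monoˡ-≤; +-assoc)
open import Data.Product using (Σ; ∃; ∃₂; _×_; _,_; proj₂; uncurry)
open import Data.Sum as Sum using (_⊎_; inj₁; inj₂; [_,_])
open import Data.Sum.Function.Propositional using (_⊎-↔_)
open import Data.Unit using (⊤; tt)
open import Data.Vec using (Vec; lookup; removeAt; fromList)
open import Data.Vec.Properties using (removeAt-punchOut)
open import Function using (_∘_; id)
open import Function.Bundles using (_↔_; _⇔_; mk⇔; Inverse; Equivalence)
open import Function.Properties.Inverse using (↔-trans; ↔-sym)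
open import Relation.Binary.Definitions using (DecidableEquality)
import Relation.Binary.Construct.Closure.Reflexive as Refl
import Relation.Binary.Construct.Closure.Transitive as Plus
open import Relation.Binary.PropositionalEquality using (_≡_; _≢_; refl; sym; trans; cong; cong₂; subst)
open import Relation.Nullary using (¬_; Dec; yes; no; does; map′; _×-dec_; _→-dec_; T?)
open import Relation.Nullary.Decidable using (decidable-stable)

-- Classical reasoning inside GL

neg : Form → Form
neg A = A ⇒ ⊥'

-- A record rather than  evalB v A ≡ true  so that v and A are inferable.
record Holds (v : Form → Bool) (A : Form) : Set where
  constructor holds
  field evalB≡true : evalB v A ≡ true

module _ {v : Form → Bool} where

  holds-⇒ : ∀ {A B} → Holds v (A ⇒ B) → Holds v A → Holds v B
  holds-⇒ (holds h) (holds a) rewrite a = holds h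

  holds-⇒-intro : ∀ {A B} → (Holds v A → Holds v B) → Holds v (A ⇒ B)
  holds-⇒-intro {A} h = holds (→-∨ (evalB v A) λ a → Holds.evalB≡true (h (holds a)))
    where
    →-∨ : ∀ a {b} → (a ≡ true → b ≡ true) → not a ∨ b ≡ true
    →-∨ true  h = h refl
    →-∨ false h = refl

  holds-em : ∀ {ℓ} {X : Set ℓ} A → (Holds v A → X) → (Holds v (neg A) → X) → X
  holds-em A f g with evalB v A in eq
  ... | true  = f (holds eq)
  ... | false = g (holds (cong (λ b → not b ∨ false) eq))

  holds-neg : ∀ {A} → Holds v (neg A) → Holds v A → ⊥
  holds-neg h a with holds-⇒ h a
  ... | holds ()

  holds-neg-intro : ∀ {A} → (Holds v A → ⊥) → Holds v (neg A)
  holds-neg-intro {A} h = holds-em A (λ a → ⊥-elim (h a)) (λ n → n)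

infixr 4 _⇛_
_⇛_ : List Form → Form → Form
[] ⇛ q = q
(p ∷ ps) ⇛ q = p ⇒ (ps ⇛ q)

holds-⇛-intro : ∀ {v} ps {q} → (All (Holds v) ps → Holds v q) → Holds v (ps ⇛ q)
holds-⇛-intro [] h = h []
holds-⇛-intro (p ∷ ps) h = holds-⇒-intro (λ a → holds-⇛-intro ps (λ as → h (a ∷ as)))

holds-⇛ : ∀ {v ps q} → Holds v (ps ⇛ q) → All (Holds v) ps → Holds v q
holds-⇛ h [] = h
holds-⇛ h (a ∷ as) = holds-⇛ (holds-⇒ h a) as

⋁ : List Form → Form
⋁ [] = ⊥'
⋁ (x ∷ xs) = neg x ⇒ ⋁ xs

holds-⋁ : ∀ {v} xs → Holds v (⋁ xs) → Any (Holds v) xs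
holds-⋁ [] (holds ())
holds-⋁ (x ∷ xs) h = holds-em x here (λ n → there (holds-⋁ xs (holds-⇒ h n)))

holds-⋁-intro : ∀ {v xs} → Any (Holds v) xs → Holds v (⋁ xs)
holds-⋁-intro (here a)  = holds-⇒-intro (λ n → ⊥-elim (holds-neg n a))
holds-⋁-intro (there a) = holds-⇒-intro (λ _ → holds-⋁-intro a)

GL-mp : ∀ {A B} → GL ⊢ A → GL ⊢ A ⇒ B → GL ⊢ B
GL-mp d e = rule (mp _ _) (d ∷ e ∷ [])

GL-nec : ∀ {A} → GL ⊢ A → GL ⊢ □ A
GL-nec d = rule (nec _) (d ∷ [])

-- ps ⇛ q is a tautology, from which q follows by modus ponens.
byTautology : ∀ {ps q} → All (GL ⊢_) ps → (∀ v → All (Holds v) ps → Holds v q) → GL ⊢ q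
byTautology {ps} {q} ds h = discharge ds (ax (taut (λ v → Holds.evalB≡true (holds-⇛-intro ps (h v)))))
  where
  discharge : ∀ {rs} → All (GL ⊢_) rs → GL ⊢ rs ⇛ q → GL ⊢ q
  discharge [] d = d
  discharge (e ∷ es) d = discharge es (GL-mp e d)

□-⇛-distrib : ∀ ps {q} → GL ⊢ □ (ps ⇛ q) ⇒ (map □_ ps ⇛ □ q)
□-⇛-distrib [] = byTautology [] (λ v _ → holds-⇒-intro (λ a → a))
□-⇛-distrib (p ∷ ps) {q} = byTautology (ax (axK p (ps ⇛ q)) ∷ □-⇛-distrib ps ∷ [])
  λ { v (k ∷ ih ∷ []) → holds-⇒-intro λ b → holds-⇒-intro λ bp → holds-⇒ ih (holds-⇒ (holds-⇒ k b) bp) }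

löb-⇛ : ∀ ps {C} → GL ⊢ ps ⇛ (□ C ⇒ C) → GL ⊢ map □_ ps ⇛ □ C
löb-⇛ ps {C} d = byTautology (GL-mp (GL-nec d) (□-⇛-distrib ps) ∷ ax (axL C) ∷ [])
  λ { v (h ∷ l ∷ []) → holds-⇛-intro (map □_ ps) (λ bs → holds-⇒ l (holds-⇛ h bs)) }

-- Finite GL models

∀-dec-↔Fin : ∀ {W : Set} {n} {P : W → Set} → W ↔ Fin n → (∀ w → Dec (P w)) → Dec (∀ w → P w)
∀-dec-↔Fin {P = P} W↔Fin P? = map′ (λ h w → subst P (strictlyInverseʳ w) (h (to w))) (λ h i → h (from i))
  (all? (P? ∘ from))
  where open Inverse W↔Fin

T-does : ∀ {X : Set} (x? : Dec X) → T (does x?) → X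
T-does (yes x) _ = x

does-T : ∀ {X : Set} (x? : Dec X) → X → T (does x?)
does-T (yes _) _ = tt
does-T (no ¬x) x = ¬x x

record GLModel : Set₁ where
  field
    W        : Set
    size     : ℕ
    enum     : W ↔ Fin size
    R        : W → W → Bool
    V        : W → ℕ → Bool
    height   : ℕ
    rank     : W → ℕ
    rank<height : ∀ w → rank w < height
    R-trans  : ∀ {x y z} → T (R x y) → T (R y z) → T (R x z)
    R-rank   : ∀ {x y} → T (R x y) → rank y < rank x

  _≺_ : W → W → Set
  x ≺ y = T (R x y)

  infix 4 _⊨_ _⊨?_
  _⊨_ : W → Form → Set
  w ⊨ var p   = T (V w p)
  w ⊨ ⊥'      = ⊥
  w ⊨ (A ⇒ B) = w ⊨ A → w ⊨ B
  w ⊨ (□ A)   = ∀ u → w ≺ u → u ⊨ A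

  _⊨?_ : ∀ w A → Dec (w ⊨ A)
  w ⊨? var p   = T? (V w p)
  w ⊨? ⊥'      = no (λ ())
  w ⊨? (A ⇒ B) = (w ⊨? A) →-dec (w ⊨? B)
  w ⊨? (□ A)   = ∀-dec-↔Fin enum (λ u → T? (R w u) →-dec (u ⊨? A))

  ⊨-stable : ∀ {w A} → ¬ ¬ w ⊨ A → w ⊨ A
  ⊨-stable {w} {A} = decidable-stable (w ⊨? A)

open GLModel public using (W)

sat : (M : GLModel) → W M → Form → Set
sat M = GLModel._⊨_ M
infix 4 sat
syntax sat M w A = w ⊨⟨ M ⟩ A

record _↪_ (M N : GLModel) : Set where
  field
    embed     : W M → W N
    R-pres    : ∀ x y → GLModel.R N (embed x) (embed y) ≡ GLModel.R M x y
    V-pres    : ∀ x p → GLModel.V N (embed x) p ≡ GLModel.V M x p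
    up-closed : ∀ x u → T (GLModel.R N (embed x) u) → ∃ λ y → u ≡ embed y
open _↪_ public

open Equivalence using (to; from)

↪-⊨ : ∀ {M N} (e : M ↪ N) x A → x ⊨⟨ M ⟩ A ⇔ embed e x ⊨⟨ N ⟩ A
↪-⊨ e x (var p) = mk⇔ (subst T (sym (V-pres e x p))) (subst T (V-pres e x p))
↪-⊨ e x ⊥' = mk⇔ (λ ()) (λ ())
↪-⊨ e x (A ⇒ B) = mk⇔ (λ h a → to (↪-⊨ e x B) (h (from (↪-⊨ e x A) a)))
                      (λ h a → from (↪-⊨ e x B) (h (to (↪-⊨ e x A) a)))
↪-⊨ e x (□ A) = mk⇔ forth back
  where
  forth : x ⊨⟨ _ ⟩ □ A → embed e x ⊨⟨ _ ⟩ □ A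
  forth h u r with up-closed e x u r
  ... | y , refl = to (↪-⊨ e y A) (h y (subst T (R-pres e x y) r))
  back : embed e x ⊨⟨ _ ⟩ □ A → x ⊨⟨ _ ⟩ □ A
  back h y r = from (↪-⊨ e y A) (h (embed e y) (subst T (sym (R-pres e x y)) r))

emptyModel : GLModel
emptyModel = record
  { W = ⊥ ; size = 0 ; enum = ↔-sym 0↔⊥ ; R = λ () ; V = λ ()
  ; height = 0 ; rank = λ () ; rank<height = λ ()
  ; R-trans = λ {x} → ⊥-elim x ; R-rank = λ {x} → ⊥-elim x }

module _ (M N : GLModel) where
  private
    module M = GLModel M
    module N = GLModel N

    R⊕ : M.W ⊎ N.W → M.W ⊎ N.W → Bool
    R⊕ (inj₁ x) (inj₁ y) = M.R x y
    R⊕ (inj₂ x) (inj₂ y) = N.R x y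
    R⊕ _        _        = false

    V⊕ : M.W ⊎ N.W → ℕ → Bool
    V⊕ (inj₁ x) = M.V x
    V⊕ (inj₂ x) = N.V x

    rank⊕ : M.W ⊎ N.W → ℕ
    rank⊕ (inj₁ x) = M.rank x
    rank⊕ (inj₂ x) = N.rank x

    rank⊕<height : ∀ w → rank⊕ w < M.height + N.height
    rank⊕<height (inj₁ x) = <-≤-trans (M.rank<height x) (m≤m+n M.height N.height)
    rank⊕<height (inj₂ x) = <-≤-trans (N.rank<height x) (m≤n+m N.height M.height)

    R⊕-trans : ∀ {x y z} → T (R⊕ x y) → T (R⊕ y z) → T (R⊕ x z)
    R⊕-trans {inj₁ _} {inj₁ _} {inj₁ _} p q = M.R-trans p q
    R⊕-trans {inj₂ _} {inj₂ _} {inj₂ _} p q = N.R-trans p q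
    R⊕-trans {inj₁ _} {inj₁ _} {inj₂ _} p ()
    R⊕-trans {inj₂ _} {inj₂ _} {inj₁ _} p ()
    R⊕-trans {inj₁ _} {inj₂ _} () q
    R⊕-trans {inj₂ _} {inj₁ _} () q

    R⊕-rank : ∀ {x y} → T (R⊕ x y) → rank⊕ y < rank⊕ x
    R⊕-rank {inj₁ _} {inj₁ _} p = M.R-rank p
    R⊕-rank {inj₂ _} {inj₂ _} p = N.R-rank p

  infixr 5 _⊕_
  _⊕_ : GLModel
  _⊕_ = record
    { W = M.W ⊎ N.W ; size = M.size + N.size ; enum = ↔-trans (M.enum ⊎-↔ N.enum) (↔-sym +↔⊎)
    ; R = R⊕ ; V = V⊕ ; height = M.height + N.height ; rank = rank⊕ ; rank<height = rank⊕<height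
    ; R-trans = λ {x} {y} {z} → R⊕-trans {x} {y} {z} ; R-rank = λ {x} {y} → R⊕-rank {x} {y} }

  inj₁-↪ : M ↪ _⊕_
  inj₁-↪ = record { embed = inj₁ ; R-pres = λ _ _ → refl ; V-pres = λ _ _ → refl
                  ; up-closed = λ { x (inj₁ y) _ → y , refl } }

  inj₂-↪ : N ↪ _⊕_
  inj₂-↪ = record { embed = inj₂ ; R-pres = λ _ _ → refl ; V-pres = λ _ _ → refl
                  ; up-closed = λ { x (inj₂ y) _ → y , refl } }

module _ (a : ℕ → Bool) (M : GLModel) where
  private
    module M = GLModel M

    R▵ : ⊤ ⊎ M.W → ⊤ ⊎ M.W → Bool
    R▵ (inj₁ _) (inj₂ _) = true
    R▵ (inj₂ x) (inj₂ y) = M.R x y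
    R▵ (inj₁ _) (inj₁ _) = false
    R▵ (inj₂ _) (inj₁ _) = false

    V▵ : ⊤ ⊎ M.W → ℕ → Bool
    V▵ (inj₁ _) = a
    V▵ (inj₂ x) = M.V x

    rank▵ : ⊤ ⊎ M.W → ℕ
    rank▵ (inj₁ _) = M.height
    rank▵ (inj₂ x) = M.rank x

    rank▵<height : ∀ w → rank▵ w < suc M.height
    rank▵<height (inj₁ _) = ≤-refl
    rank▵<height (inj₂ x) = m<n⇒m<1+n (M.rank<height x)

    R▵-trans : ∀ {x y z} → T (R▵ x y) → T (R▵ y z) → T (R▵ x z)
    R▵-trans {inj₁ _} {inj₂ _} {inj₂ _} p q = tt
    R▵-trans {inj₂ _} {inj₂ _} {inj₂ _} p q = M.R-trans p q
    R▵-trans {inj₁ _} {inj₂ _} {inj₁ _} p ()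
    R▵-trans {inj₂ _} {inj₂ _} {inj₁ _} p ()
    R▵-trans {inj₁ _} {inj₁ _} {_}      () q
    R▵-trans {inj₂ _} {inj₁ _} {_}      () q

    R▵-rank : ∀ {x y} → T (R▵ x y) → rank▵ y < rank▵ x
    R▵-rank {inj₁ _} {inj₂ y} p = M.rank<height y
    R▵-rank {inj₂ _} {inj₂ _} p = M.R-rank p

  cone : GLModel
  cone = record
    { W = ⊤ ⊎ M.W ; size = suc M.size ; enum = ↔-trans (↔-sym 1↔⊤ ⊎-↔ M.enum) (↔-sym +↔⊎)
    ; R = R▵ ; V = V▵ ; height = suc M.height ; rank = rank▵ ; rank<height = rank▵<height
    ; R-trans = λ {x} {y} {z} → R▵-trans {x} {y} {z} ; R-rank = λ {x} {y} → R▵-rank {x} {y} }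

  root : W cone
  root = inj₁ tt

  cone-everywhere : ∀ {A} → root ⊨⟨ cone ⟩ A → root ⊨⟨ cone ⟩ □ A → ∀ w → w ⊨⟨ cone ⟩ A
  cone-everywhere rootA _    (inj₁ _) = rootA
  cone-everywhere _    root□A (inj₂ x) = root□A (inj₂ x) tt

  cone-↪ : M ↪ cone
  cone-↪ = record { embed = inj₂ ; R-pres = λ _ _ → refl ; V-pres = λ _ _ → refl
                  ; up-closed = λ { x (inj₂ y) _ → y , refl } }

-- Finite GL models as provability models

data GLRules : List Form → Form → Set where
  mp  : ∀ A B → GLRules (A ∷ (A ⇒ B) ∷ []) B
  nec : ∀ A → GLRules (A ∷ []) (□ A)
  löb : ∀ A → GLRules ((□ A ⇒ A) ∷ []) A

module ProvabilityModelOf (M : GLModel) (w₀ : W M) where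
  open GLModel M hiding (W)

  _≼_ : W M → W M → Set
  _≼_ = Refl.ReflClosure _≺_

  ≼-≺-trans : ∀ {w v u} → w ≼ v → v ≺ u → w ≺ u
  ≼-≺-trans Refl.refl  r = r
  ≼-≺-trans Refl.[ p ] r = R-trans p r

  ≺-≼-trans : ∀ {w u v} → w ≺ u → u ≼ v → w ≺ v
  ≺-≼-trans r Refl.refl  = r
  ≺-≼-trans r Refl.[ p ] = R-trans r p

  theory : W M → Theory
  theory w = record { Ax = λ B → ∀ v → w ≼ v → v ⊨ B ; Rule = GLRules }

  löb-sound : ∀ w A → (∀ v → w ≼ v → v ⊨ □ A ⇒ A) → ∀ v → w ≼ v → v ⊨ A
  löb-sound w A h v w≼v = go (suc (rank v)) v (s≤s ≤-refl) w≼v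
    where
    go : ∀ n v → rank v < n → w ≼ v → v ⊨ A
    go (suc n) v (s≤s rv≤n) w≼v = h v w≼v λ u v≺u → go n u (≤-trans (R-rank v≺u) rv≤n) Refl.[ ≼-≺-trans w≼v v≺u ]

  sound : ∀ {w B} → theory w ⊢ B → ∀ v → w ≼ v → v ⊨ B
  sound (ax h) = h
  sound (rule (mp A B) (d ∷ e ∷ [])) v w≼v = sound e v w≼v (sound d v w≼v)
  sound (rule (nec A) (d ∷ [])) v w≼v u v≺u = sound d u Refl.[ ≼-≺-trans w≼v v≺u ]
  sound {w} (rule (löb A) (d ∷ [])) = löb-sound w A (sound d)

  tautology-sound : ∀ {A} → Tautology A → ∀ w → w ⊨ A
  tautology-sound {A} t w = T-does (w ⊨? A) (subst T (trans (sym (t decision)) (evalB-decides A)) tt)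
    where
    decision : Form → Bool
    decision X = does (w ⊨? X)
    evalB-decides : ∀ A → evalB decision A ≡ does (w ⊨? A)
    evalB-decides (var p) = refl
    evalB-decides ⊥' = refl
    evalB-decides (A ⇒ B) = cong₂ (λ a b → not a ∨ b) (evalB-decides A) (evalB-decides B)
    evalB-decides (□ A) = refl

  provabilityModel : PreModel
  provabilityModel = record { W = W M ; inh = w₀ ; _⊏_ = _≺_ ; L = theory ; V = λ w p → T (V w p) }

  open PreModel provabilityModel using (_⊩_; IsProvabilityModel; Finite; Transitive; Irreflexive; HasNecessitation; HasLöbRule)

  ⊩⇔⊨ : ∀ w A → w ⊩ A ⇔ w ⊨ A
  ⊩⇔⊨ w (var p) = mk⇔ (λ h → h) (λ h → h)
  ⊩⇔⊨ w ⊥' = mk⇔ (λ ()) (λ ())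
  ⊩⇔⊨ w (A ⇒ B) = mk⇔ (λ h a → to (⊩⇔⊨ w B) (h (from (⊩⇔⊨ w A) a)))
                       (λ h a → from (⊩⇔⊨ w B) (h (to (⊩⇔⊨ w A) a)))
  ⊩⇔⊨ w (□ A) = mk⇔ (λ h u w≺u → sound (h u w≺u) u Refl.refl)
                     (λ h u w≺u → ax λ v u≼v → h v (≺-≼-trans w≺u u≼v))

  ≺-≼⇒⁺ : ∀ {u w v} → u ≺ w → w ≼ v → PreModel._⊏⁺_ provabilityModel u v
  ≺-≼⇒⁺ r Refl.refl  = Plus.[ r ]
  ≺-≼⇒⁺ r Refl.[ p ] = r Plus.∷ Plus.[ p ]

  isProvabilityModel : IsProvabilityModel
  isProvabilityModel = (λ _ _ → (λ A B → mp A B) , (λ A t → ax (λ v _ → tautology-sound {A} t v)))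
                     , (λ { w _ A _ (u , u≺w , h) → ax (λ v w≼v → to (⊩⇔⊨ v A) (h v (≺-≼⇒⁺ u≺w w≼v))) })

  finite : Finite
  finite = size , enum

  irreflexive : Irreflexive
  irreflexive x x≺x = <-irrefl refl (R-rank x≺x)

ValidInFiniteProvabilityModels : Form → Set₁
ValidInFiniteProvabilityModels A =
  ∀ (P : PreModel) → PreModel.IsProvabilityModel P → PreModel.Finite P → PreModel.Transitive P →
  PreModel.Irreflexive P → PreModel.HasNecessitation P → PreModel.HasLöbRule P → Valid P A

valid⇒GLModel-valid : ∀ {A} → ValidInFiniteProvabilityModels A → ∀ M w → w ⊨⟨ M ⟩ A
valid⇒GLModel-valid {A} valid M w =
  to (⊩⇔⊨ w A) (valid provabilityModel isProvabilityModel finite (GLModel.R-trans M) irreflexive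
                                  (λ _ _ → nec) (λ _ _ → löb) w)
  where open ProvabilityModelOf M w

-- Proof search for GL sequents

Lit : Set
Lit = Bool × Form

-- (true , A) puts A on the left of the sequent, (false , A) on the right;
-- a sequent is read as the disjunction of the forms of its literals.
litForm : Lit → Form
litForm (true , A)  = neg A
litForm (false , A) = A

Sat : (Form → Bool) → List Lit → Set
Sat v = Any (Holds v ∘ litForm)

sat-∈ : ∀ {v l ls} → l ∈ ls → Holds v (litForm l) → Sat v ls
sat-∈ = lose

record Provable (ls : List Lit) : Set where
  constructor provable
  field derivation : GL ⊢ ⋁ (map litForm ls)

Refutes : (M : GLModel) → W M → List Lit → Set
Refutes M w ls = ∀ {l} → l ∈ ls → ¬ (w ⊨⟨ M ⟩ litForm l)

Countermodel : List Lit → Set₁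
Countermodel ls = Σ (ℕ → Bool) λ a → Σ GLModel λ M → Refutes (cone a M) (root a M) ls

Decided : List Lit → Set₁
Decided ls = Provable ls ⊎ Countermodel ls

provable-by : ∀ {lss ls} → All Provable lss → (∀ v → All (Sat v) lss → Sat v ls) → Provable ls
provable-by ds h = provable (byTautology (All.map⁺ (All.map Provable.derivation ds)) λ v hs →
  holds-⋁-intro (Any.map⁺ (h v (All.map (Any.map⁻ ∘ holds-⋁ _) (All.map⁻ hs)))))

decided-↭ : ∀ {ls ls′} → ls ↭ ls′ → Decided ls → Decided ls′
decided-↭ p (inj₁ d) = inj₁ (provable-by (d ∷ []) λ { v (s ∷ []) → Any-resp-↭ p s })
decided-↭ p (inj₂ (a , M , r)) = inj₂ (a , M , r ∘ Any-resp-↭ (↭-sym p))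

provable-⊥ˡ : ∀ {ls} → Provable ((true , ⊥') ∷ ls)
provable-⊥ˡ = provable-by [] λ v _ → here (holds-⇒-intro (λ a → a))

decided-⊥ʳ : ∀ {ls} → Decided ls → Decided ((false , ⊥') ∷ ls)
decided-⊥ʳ (inj₁ d) = inj₁ (provable-by (d ∷ []) λ { v (s ∷ []) → there s })
decided-⊥ʳ (inj₂ (a , M , r)) = inj₂ (a , M , λ { (here refl) () ; (there l∈) → r l∈ })

decided-⇒ˡ : ∀ {C E ls} → Decided ((false , C) ∷ ls) → Decided ((true , E) ∷ ls) → Decided ((true , C ⇒ E) ∷ ls)
decided-⇒ˡ (inj₂ (a , M , r)) _ = inj₂ (a , M , λ
  { (here refl) ¬C⇒E → ¬C⇒E λ c → ⊥-elim (r (here refl) c) ; (there l∈) → r (there l∈) })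
decided-⇒ˡ (inj₁ _) (inj₂ (a , M , r)) = inj₂ (a , M , λ
  { (here refl) ¬C⇒E → r (here refl) λ e → ¬C⇒E λ _ → e ; (there l∈) → r (there l∈) })
decided-⇒ˡ {C} {E} (inj₁ d₁) (inj₁ d₂) = inj₁ (provable-by (d₁ ∷ d₂ ∷ []) λ
  { v (there s ∷ _) → there s
  ; v (here _ ∷ there s ∷ []) → there s
  ; v (here c ∷ here ¬e ∷ []) → here (holds-neg-intro λ c⇒e → holds-neg ¬e (holds-⇒ c⇒e c)) })

decided-⇒ʳ : ∀ {C E ls} → Decided ((true , C) ∷ (false , E) ∷ ls) → Decided ((false , C ⇒ E) ∷ ls)
decided-⇒ʳ (inj₁ d) = inj₁ (provable-by (d ∷ []) λ
  { v (here ¬c ∷ []) → here (holds-⇒-intro λ c → ⊥-elim (holds-neg ¬c c))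
  ; v (there (here e) ∷ []) → here (holds-⇒-intro λ _ → e)
  ; v (there (there s) ∷ []) → there s })
decided-⇒ʳ (inj₂ (a , M , r)) = inj₂ (a , M , λ
  { (here refl) c⇒e → r (here refl) λ c → r (there (here refl)) (c⇒e c)
  ; (there l∈) → r (there (there l∈)) })

infix 4 _≟_
_≟_ : DecidableEquality Form
var p ≟ var q = map′ (cong var) (λ { refl → refl }) (p ℕ.≟ q)
⊥' ≟ ⊥' = yes refl
(A ⇒ B) ≟ (C ⇒ D) = map′ (uncurry (cong₂ _⇒_)) (λ { refl → refl , refl }) ((A ≟ C) ×-dec (B ≟ D))
(□ A) ≟ (□ B) = map′ (cong □_) (λ { refl → refl }) (A ≟ B)
var _ ≟ ⊥' = no λ ()
var _ ≟ (_ ⇒ _) = no λ ()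
var _ ≟ □ _ = no λ ()
⊥' ≟ var _ = no λ ()
⊥' ≟ (_ ⇒ _) = no λ ()
⊥' ≟ □ _ = no λ ()
(_ ⇒ _) ≟ var _ = no λ ()
(_ ⇒ _) ≟ ⊥' = no λ ()
(_ ⇒ _) ≟ □ _ = no λ ()
□ _ ≟ var _ = no λ ()
□ _ ≟ ⊥' = no λ ()
□ _ ≟ (_ ⇒ _) = no λ ()

-- The literals that the propositional rules cannot decompose further.
data Stored : Set where
  atom  : Bool → ℕ → Stored
  boxed : Bool → Form → Stored

_≟ˢ_ : DecidableEquality Stored
atom b p ≟ˢ atom c q = map′ (uncurry (cong₂ atom)) (λ { refl → refl , refl }) ((b Bool.≟ c) ×-dec (p ℕ.≟ q))
boxed b A ≟ˢ boxed c B = map′ (uncurry (cong₂ boxed)) (λ { refl → refl , refl }) ((b Bool.≟ c) ×-dec (A ≟ B))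
atom _ _ ≟ˢ boxed _ _ = no λ ()
boxed _ _ ≟ˢ atom _ _ = no λ ()

open DecMembership _≟ˢ_ using (_∈?_)

stored : Stored → Lit
stored (atom b p)  = b , var p
stored (boxed b A) = b , □ A

opposite : Stored → Stored
opposite (atom b p)  = atom (not b) p
opposite (boxed b A) = boxed (not b) A

Clash : List Stored → Set
Clash D = Any (λ d → opposite d ∈ D) D

clash? : ∀ D → Dec (Clash D)
clash? D = any? (λ d → opposite d ∈? D) D

boxesOf : Bool → List Stored → List Form
boxesOf b [] = []
boxesOf b (atom _ _ ∷ D) = boxesOf b D
boxesOf b (boxed c A ∷ D) with b Bool.≟ c
... | yes _ = A ∷ boxesOf b D
... | no _  = boxesOf b D

∈-boxesOf⁺ : ∀ {b A D} → boxed b A ∈ D → A ∈ boxesOf b D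
∈-boxesOf⁺ {b} {D = boxed c B ∷ D} (here refl) with b Bool.≟ c
... | yes _ = here refl
... | no b≢b = ⊥-elim (b≢b refl)
∈-boxesOf⁺ {D = atom _ _ ∷ D} (there A∈) = ∈-boxesOf⁺ A∈
∈-boxesOf⁺ {b} {D = boxed c B ∷ D} (there A∈) with b Bool.≟ c
... | yes _ = there (∈-boxesOf⁺ A∈)
... | no _  = ∈-boxesOf⁺ A∈

∈-boxesOf⁻ : ∀ {b A} D → A ∈ boxesOf b D → boxed b A ∈ D
∈-boxesOf⁻ (atom _ _ ∷ D) A∈ = there (∈-boxesOf⁻ D A∈)
∈-boxesOf⁻ {b} (boxed c B ∷ D) A∈ with b Bool.≟ c
∈-boxesOf⁻ {b} (boxed c B ∷ D) (here refl) | yes refl = here refl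
∈-boxesOf⁻ {b} (boxed c B ∷ D) (there A∈)  | yes _ = there (∈-boxesOf⁻ D A∈)
∈-boxesOf⁻ {b} (boxed c B ∷ D) A∈          | no _  = there (∈-boxesOf⁻ D A∈)

sequent : List Lit → List Stored → List Lit
sequent P D = P ++ map stored D

leftBoxes rightBoxes : List Stored → List Form
leftBoxes  = boxesOf true
rightBoxes = boxesOf false

-- The GL rule read upwards: for □C on the right of D, the premise is
-- G, □G, □C ⊢ C, where □G are the boxes on the left of D.
premiseP : List Stored → Form → List Lit
premiseP D C = (false , C) ∷ map (true ,_) (leftBoxes D)

premiseD : List Stored → Form → List Stored
premiseD D C = boxed true C ∷ map (boxed true) (leftBoxes D)

premise : List Stored → Form → List Lit
premise D C = sequent (premiseP D C) (premiseD D C)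

premiseLefts : List Stored → Form → List Form
premiseLefts D C = □ C ∷ leftBoxes D ++ map □_ (leftBoxes D)

data PremiseLit (D : List Stored) (C : Form) : Lit → Set where
  goal : PremiseLit D C (false , C)
  left : ∀ {Z} → Z ∈ premiseLefts D C → PremiseLit D C (true , Z)

∈-premise⁻ : ∀ D {C l} → l ∈ premise D C → PremiseLit D C l
∈-premise⁻ D (here refl) = goal
∈-premise⁻ D (there l∈) with ∈-++⁻ (map (true ,_) (leftBoxes D)) l∈
... | inj₁ l∈G with ∈-map⁻ (true ,_) l∈G
...   | X , X∈ , refl = left (there (∈-++⁺ˡ X∈))
∈-premise⁻ D (there l∈) | inj₂ (here refl) = left (here refl)
∈-premise⁻ D (there l∈) | inj₂ (there l∈□G) with ∈-map⁻ stored l∈□G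
... | d , d∈ , refl with ∈-map⁻ (boxed true) d∈
...   | X , X∈ , refl = left (there (∈-++⁺ʳ (leftBoxes D) (∈-map⁺ □_ X∈)))

any-or-all : ∀ {a p q} {A : Set a} {P : A → Set p} {Q : A → Set q} xs →
             (∀ {x} → x ∈ xs → P x ⊎ Q x) → Any P xs ⊎ All Q xs
any-or-all [] _ = inj₂ []
any-or-all (x ∷ xs) pq with pq (here refl) | any-or-all xs (pq ∘ there)
... | inj₁ px | _ = inj₁ (here px)
... | inj₂ _  | inj₁ pxs = inj₁ (there pxs)
... | inj₂ qx | inj₂ qxs = inj₂ (qx ∷ qxs)

clash-provable : ∀ {D} → Clash D → Provable (map stored D)
clash-provable c with find c
... | d , d∈ , opp∈ = provable-by [] λ v _ →
  [ sat-∈ (∈-map⁺ stored d∈) , sat-∈ (∈-map⁺ stored opp∈) ] (opposites v d)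
  where
  complementary : ∀ v b A → Holds v (litForm (b , A)) ⊎ Holds v (litForm (not b , A))
  complementary v true  A = holds-em A inj₂ inj₁
  complementary v false A = holds-em A inj₁ inj₂
  opposites : ∀ v d → Holds v (litForm (stored d)) ⊎ Holds v (litForm (stored (opposite d)))
  opposites v (atom b p)  = complementary v b (var p)
  opposites v (boxed b A) = complementary v b (□ A)

glr-provable : ∀ {C} D → boxed false C ∈ D → Provable (premise D C) → Provable (map stored D)
-- Löb's axiom turns  G, □G ⊢ □C → C  into  □G, □□G ⊢ □C, and axiom 4
-- supplies □□G from □G.
glr-provable {C} D C∈ (provable d) =
  provable (byTautology (löb-⇛ (G ++ map □_ G) premise⇒ ∷ All.map⁺ (All.universal (λ X → ax (ax4 X)) G))
    λ { v (□G⇒□C ∷ ax4s) → holds-⋁-intro (Any.map⁺ (conclusion v □G⇒□C (All.map⁻ ax4s))) })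
  where
  G = leftBoxes D
  premise⇒ : GL ⊢ G ++ map □_ G ⇛ (□ C ⇒ C)
  premise⇒ = byTautology (d ∷ []) λ { v (h ∷ []) → holds-⇛-intro (G ++ map □_ G) λ hs → holds-⇒-intro λ □c →
    goal-holds v (find (Any.map⁻ (holds-⋁ _ h))) (□c ∷ hs) }
    where
    goal-holds : ∀ v → Σ Lit (λ l → l ∈ premise D C × Holds v (litForm l)) → All (Holds v) (premiseLefts D C) → Holds v C
    goal-holds v (l , l∈ , h) hs with ∈-premise⁻ D l∈
    ... | goal = h
    ... | left Z∈ = ⊥-elim (holds-neg h (All.lookup hs Z∈))
  conclusion : ∀ v → Holds v (map □_ (G ++ map □_ G) ⇛ □ C) → All (λ X → Holds v (□ X ⇒ □ □ X)) G → Sat v (map stored D)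
  conclusion v □G⇒□C ax4s with any-or-all G (λ {X} _ → holds-em {v = v} (□ X) inj₂ inj₁)
  ... | inj₁ ¬□X with find ¬□X
  ...   | X , X∈ , h = sat-∈ (∈-map⁺ stored (∈-boxesOf⁻ D X∈)) h
  conclusion v □G⇒□C ax4s | inj₂ □G = sat-∈ (∈-map⁺ stored C∈) (holds-⇛ □G⇒□C (All.map⁺ (All.++⁺ □G □□G)))
    where
    □□G : All (Holds v ∘ □_) (map □_ G)
    □□G = All.map⁺ (All.zipWith (λ (a4 , □x) → holds-⇒ a4 □x) (ax4s , □G))

module _ (D : List Stored) (noClash : ¬ Clash D) where

  PremiseCountermodels : List Form → Set₁
  PremiseCountermodels = All (λ C → Countermodel (premise D C))

  forest : ∀ {cs} → PremiseCountermodels cs → GLModel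
  forest [] = emptyModel
  forest ((a , M , _) ∷ cms) = cone a M ⊕ forest cms

  forest-⊨-leftBoxes : ∀ {cs} (cms : PremiseCountermodels cs) {X} → X ∈ leftBoxes D → ∀ w → w ⊨⟨ forest cms ⟩ X
  forest-⊨-leftBoxes ((a , M , r) ∷ cms) {X} X∈ (inj₁ w) =
    to (↪-⊨ (inj₁-↪ _ _) w X) (cone-everywhere a M {X} (stable X X∈premise) (stable (□ X) □X∈premise) w)
    where
    stable : ∀ A → (true , A) ∈ premise D _ → root a M ⊨⟨ cone a M ⟩ A
    stable A A∈ = GLModel.⊨-stable (cone a M) {root a M} {A} (r A∈)
    X∈premise = there (∈-++⁺ˡ (∈-map⁺ (true ,_) X∈))
    □X∈premise = there (∈-++⁺ʳ (map (true ,_) (leftBoxes D)) (there (∈-map⁺ stored (∈-map⁺ (boxed true) X∈))))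
  forest-⊨-leftBoxes (_ ∷ cms) {X} X∈ (inj₂ w) = to (↪-⊨ (inj₂-↪ _ _) w X) (forest-⊨-leftBoxes cms X∈ w)

  forest-refutes : ∀ {cs} (cms : PremiseCountermodels cs) {C} → C ∈ cs → ∃ λ w → ¬ w ⊨⟨ forest cms ⟩ C
  forest-refutes ((a , M , r) ∷ cms) {C} (here refl) =
    inj₁ (root a M) , λ c → r (here refl) (from (↪-⊨ (inj₁-↪ _ _) (root a M) C) c)
  forest-refutes (_ ∷ cms) {C} (there C∈) with forest-refutes cms C∈
  ... | w , ¬c = inj₂ w , λ c → ¬c (from (↪-⊨ (inj₂-↪ _ _) w C) c)

  rootAtoms : ℕ → Bool
  rootAtoms p = does (atom true p ∈? D)

  countermodel : PremiseCountermodels (rightBoxes D) → Countermodel (map stored D)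
  countermodel cms = rootAtoms , F , refutes
    where
    F = forest cms
    refute : ∀ d → d ∈ D → ¬ root rootAtoms F ⊨⟨ cone rootAtoms F ⟩ litForm (stored d)
    refute (atom true p) d∈ ¬vp = ¬vp (does-T (atom true p ∈? D) d∈)
    refute (atom false p) d∈ vp = noClash (lose d∈ (T-does (atom true p ∈? D) vp))
    refute (boxed true X) d∈ ¬□X = ¬□X λ
      { (inj₂ w) _ → to (↪-⊨ (cone-↪ rootAtoms F) w X) (forest-⊨-leftBoxes cms (∈-boxesOf⁺ d∈) w) }
    refute (boxed false C) d∈ □C with forest-refutes cms (∈-boxesOf⁺ d∈)
    ... | w , ¬c = ¬c (from (↪-⊨ (cone-↪ rootAtoms F) w C) (□C (inj₂ w) tt))
    refutes : Refutes (cone rootAtoms F) (root rootAtoms F) (map stored D)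
    refutes l∈ with ∈-map⁻ stored l∈
    ... | d , d∈ , refl = refute d d∈

infix 4 _∈□_ _∈□ˢ_ _∈ᵛ_

data _∈□_ (Y : Form) : Form → Set where
  □-here  : Y ∈□ □ Y
  □-there : ∀ {A} → Y ∈□ A → Y ∈□ □ A
  ⇒-left  : ∀ {A B} → Y ∈□ A → Y ∈□ A ⇒ B
  ⇒-right : ∀ {A B} → Y ∈□ B → Y ∈□ A ⇒ B

_∈□ˢ_ : Form → List Lit → Set
Y ∈□ˢ ls = Any (λ l → Y ∈□ proj₂ l) ls

_∈ᵛ_ : ∀ {k} → Form → Vec Form k → Set
Y ∈ᵛ R = ∃ λ j → lookup R j ≡ Y

-- Every boxed subformula of the sequent is either already used as a
-- left box or still available in R; the modal rule consumes one entry of R.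
record Covered {k} (R : Vec Form k) (P : List Lit) (D : List Stored) : Set where
  constructor covered
  field cover : ∀ {Y} → Y ∈□ˢ sequent P D → boxed true Y ∈ D ⊎ Y ∈ᵛ R
open Covered

covered-resp : ∀ {k} {R : Vec Form k} {P P′ D D′} → (∀ {Y} → Y ∈□ˢ sequent P′ D′ → Y ∈□ˢ sequent P D) →
               D ⊆ D′ → Covered R P D → Covered R P′ D′
covered-resp occ D⊆D′ cov = covered λ Y∈ → Sum.map₁ D⊆D′ (cover cov (occ Y∈))

rightBox-covered : ∀ {k} {R : Vec Form k} {D C} → Covered R [] D → ¬ Clash D → C ∈ rightBoxes D → C ∈ᵛ R
rightBox-covered {D = D} cov noClash C∈ with cover cov (lose (∈-map⁺ stored (∈-boxesOf⁻ D C∈)) □-here)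
... | inj₁ C∈left = ⊥-elim (noClash (lose (∈-boxesOf⁻ D C∈) C∈left))
... | inj₂ C∈R = C∈R

covered-premise : ∀ {k} (R : Vec Form (suc k)) D {C} i → lookup R i ≡ C → boxed false C ∈ D →
                  Covered R [] D → Covered (removeAt R i) (premiseP D C) (premiseD D C)
covered-premise R D {C} i Ri≡C C∈ cov = covered λ Y∈ → classify (find Y∈)
  where
  □C∈D : (false , □ C) ∈ map stored D
  □C∈D = ∈-map⁺ stored C∈
  □X∈D : ∀ {X} → X ∈ leftBoxes D → (true , □ X) ∈ map stored D
  □X∈D X∈ = ∈-map⁺ stored (∈-boxesOf⁻ D X∈)
  occurs : ∀ {l Y} → PremiseLit D C l → Y ∈□ proj₂ l → Y ∈□ˢ map stored D
  occurs goal Y∈C = lose □C∈D (□-there Y∈C)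
  occurs (left (here refl)) Y∈□C = lose □C∈D Y∈□C
  occurs (left (there Z∈)) Y∈Z with ∈-++⁻ (leftBoxes D) Z∈
  ... | inj₁ X∈ = lose (□X∈D X∈) (□-there Y∈Z)
  ... | inj₂ □X∈ with ∈-map⁻ □_ □X∈
  ...   | X , X∈ , refl = lose (□X∈D X∈) Y∈Z
  shrink : ∀ {Y} → boxed true Y ∈ D ⊎ Y ∈ᵛ R → boxed true Y ∈ premiseD D C ⊎ Y ∈ᵛ removeAt R i
  shrink (inj₁ Y∈D) = inj₁ (there (∈-map⁺ (boxed true) (∈-boxesOf⁺ Y∈D)))
  shrink {Y} (inj₂ (j , Rj≡Y)) with Y ≟ C
  ... | yes refl = inj₁ (here refl)
  ... | no Y≢C = inj₂ (punchOut i≢j , trans (removeAt-punchOut R i≢j) Rj≡Y)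
    where
    i≢j : i ≢ j
    i≢j i≡j = Y≢C (trans (sym Rj≡Y) (trans (cong (lookup R) (sym i≡j)) Ri≡C))
  classify : ∀ {Y} → Σ Lit (λ l → l ∈ premise D C × Y ∈□ proj₂ l) → boxed true Y ∈ premiseD D C ⊎ Y ∈ᵛ removeAt R i
  classify (l , l∈ , Y∈l) = shrink (cover cov (occurs (∈-premise⁻ D l∈) Y∈l))

weight : Form → ℕ
weight (var _) = 1
weight ⊥'      = 1
weight (A ⇒ B) = suc (weight A + weight B)
weight (□ A)   = suc (weight A)

size : List Lit → ℕ
size [] = 0
size ((_ , A) ∷ ls) = weight A + size ls

decided-store : ∀ d P D → Decided (sequent P (d ∷ D)) → Decided (sequent (stored d ∷ P) D)
decided-store d P D = decided-↭ (shift (stored d) P (map stored D))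

covered-store : ∀ {k} {R : Vec Form k} d P D → Covered R (stored d ∷ P) D → Covered R P (d ∷ D)
covered-store d P D = covered-resp (Any-resp-↭ (shift (stored d) P (map stored D))) there

decide-modal : ∀ {k} (R : Vec Form k) D → Covered R [] D →
               (∀ {C} → boxed false C ∈ D → C ∈ᵛ R → Decided (premise D C)) → Decided (map stored D)
decide-modal R D cov decide-premise with clash? D
... | yes c = inj₁ (clash-provable c)
... | no noClash with any-or-all (rightBoxes D) (λ C∈ →
                        decide-premise (∈-boxesOf⁻ D C∈) (rightBox-covered cov noClash C∈))
...   | inj₂ cms = inj₂ (countermodel D noClash cms)
...   | inj₁ provablePremise with find provablePremise
...     | C , C∈ , d = inj₁ (glr-provable D (∈-boxesOf⁻ D C∈) d)

-- Lexicographic recursion: on k, the number of boxed subformulas still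
-- available, and (through the fuel n) on the size of the unprocessed literals.
decide : ∀ k (R : Vec Form k) n P D → size P ≤ n → Covered R P D → Decided (sequent P D)
decide k R n [] D _ cov = decide-modal R D cov (decide-premise cov)
  where
  decide-premise : ∀ {k} {R : Vec Form k} → Covered R [] D → ∀ {C} → boxed false C ∈ D → C ∈ᵛ R → Decided (premise D C)
  decide-premise {suc k} {R} cov C∈ (i , Ri≡C) =
    decide k (removeAt R i) _ (premiseP D _) (premiseD D _) ≤-refl (covered-premise R D i Ri≡C C∈ cov)
decide k R (suc n) ((b , var p) ∷ P) D (s≤s le) cov =
  decided-store (atom b p) P D (decide k R n P (atom b p ∷ D) le (covered-store (atom b p) P D cov))
decide k R (suc n) ((b , □ Y) ∷ P) D (s≤s le) cov =
  decided-store (boxed b Y) P D (decide k R n P (boxed b Y ∷ D) (≤-trans (m≤n+m _ (weight Y)) le)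
                                 (covered-store (boxed b Y) P D cov))
decide k R (suc n) ((true , ⊥') ∷ P) D _ _ = inj₁ provable-⊥ˡ
decide k R (suc n) ((false , ⊥') ∷ P) D (s≤s le) cov = decided-⊥ʳ (decide k R n P D le (covered-resp there id cov))
decide k R (suc n) ((true , C ⇒ E) ∷ P) D (s≤s le) cov = decided-⇒ˡ
  (decide k R n ((false , C) ∷ P) D (≤-trans (+-monoˡ-≤ (size P) (m≤m+n (weight C) (weight E))) le)
          (covered-resp (λ { (here Y∈C) → here (⇒-left Y∈C) ; (there Y∈) → there Y∈ }) id cov))
  (decide k R n ((true , E) ∷ P) D (≤-trans (+-monoˡ-≤ (size P) (m≤n+m (weight E) (weight C))) le)
          (covered-resp (λ { (here Y∈E) → here (⇒-right Y∈E) ; (there Y∈) → there Y∈ }) id cov))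
decide k R (suc n) ((false , C ⇒ E) ∷ P) D (s≤s le) cov = decided-⇒ʳ
  (decide k R n ((true , C) ∷ (false , E) ∷ P) D (subst (_≤ n) (+-assoc (weight C) (weight E) (size P)) le)
          (covered-resp (λ { (here Y∈C) → here (⇒-left Y∈C) ; (there (here Y∈E)) → here (⇒-right Y∈E)
                           ; (there (there Y∈)) → there Y∈ }) id cov))

boxSubformulas : Form → List Form
boxSubformulas (var _) = []
boxSubformulas ⊥'      = []
boxSubformulas (A ⇒ B) = boxSubformulas A ++ boxSubformulas B
boxSubformulas (□ A)   = A ∷ boxSubformulas A

∈□⇒∈boxSubformulas : ∀ {Y A} → Y ∈□ A → Y ∈ boxSubformulas A
∈□⇒∈boxSubformulas □-here = here refl
∈□⇒∈boxSubformulas (□-there Y∈) = there (∈□⇒∈boxSubformulas Y∈)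
∈□⇒∈boxSubformulas (⇒-left Y∈) = ∈-++⁺ˡ (∈□⇒∈boxSubformulas Y∈)
∈□⇒∈boxSubformulas (⇒-right {A} Y∈) = ∈-++⁺ʳ (boxSubformulas A) (∈□⇒∈boxSubformulas Y∈)

∈⇒∈ᵛfromList : ∀ {Y xs} → Y ∈ xs → Y ∈ᵛ fromList xs
∈⇒∈ᵛfromList (here refl) = zero , refl
∈⇒∈ᵛfromList (there Y∈) with ∈⇒∈ᵛfromList Y∈
... | j , Rj≡Y = suc j , Rj≡Y

provable-or-refutable : ∀ A → GL ⊢ A ⊎ ∃₂ λ M w → ¬ w ⊨⟨ M ⟩ A
provable-or-refutable A with decide _ (fromList (boxSubformulas A)) _ ((false , A) ∷ []) [] ≤-refl initial
  where
  initial : Covered (fromList (boxSubformulas A)) ((false , A) ∷ []) []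
  initial = covered λ { (here Y∈A) → inj₂ (∈⇒∈ᵛfromList (∈□⇒∈boxSubformulas Y∈A)) }
... | inj₁ (provable d) = inj₁ (byTautology (d ∷ []) λ { v (h ∷ []) → Any.singleton⁻ (holds-⋁ _ h) })
... | inj₂ (a , M , refutes) = inj₂ (cone a M , root a M , refutes (here refl))

GL-complete : ∀ {A} → (∀ M w → w ⊨⟨ M ⟩ A) → GL ⊢ A
GL-complete {A} valid with provable-or-refutable A
... | inj₁ d = d
... | inj₂ (M , w , ¬A) = ⊥-elim (¬A (valid M w))

theorem3p17 : ∀ (A : Form) →
    (∀ (P : PreModel) →
      PreModel.IsProvabilityModel P →
      PreModel.Finite P →
      PreModel.Transitive P →
      PreModel.Irreflexive P →
      PreModel.HasNecessitation P →
      PreModel.HasLöbRule P →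
      Valid P A) →
    GL ⊢ A
theorem3p17 A valid = GL-complete (valid⇒GLModel-valid {A} valid)
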